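{- Let $(V,\mathcal{E},\mathcal{B},k)$ be an instance of Subset-Test-$r$-Cover$(m-k)$ to which Rules 1 and 2 do not apply, in which every vertex has degree at most $kr^2$, and whose non-black edges have been colored as described below. Let $o$ be an orange edge such that $N_2[o]$ contains no green edge, and let $(V,\mathcal{E}',\mathcal{B}',k-1)$ be obtained by deleting $o$ and decreasing $k$ by $1$ (Rule 3). Then $(V,\mathcal{E}',\mathcal{B}',k-1)$ is a yes-instance if and only if $(V,\mathcal{E},\mathcal{B},k)$ is a yes-instance.
   Context: An edge $e$ of a hypergraph $(V,\mathcal{E})$ separates vertices $x,y$ if $|\{x,y\}\cap e|=1$; $\mathcal{T}\subseteq\mathcal{E}$ is a test cover if every pair of distinct vertices is separated by an edge of $\mathcal{T}$. The degree of a vertex is the number of edges containing it. An edge $e$ cuts a set $X$ if $X\cap e\ne\emptyset$ and $X\setminus e\neq\emptyset$. For $\mathcal{F}\subseteq\mathcal{E}$, $N_1(\mathcal{F})=\{e\in\mathcal{E}\setminus\mathcal{F}: \exists f\in\mathcal{F},\ f\cap e\neq\emptyset\}$, $N_1[\mathcal{F}]=N_1(\mathcal{F})\cup\mathcal{F}$, $N_j[\mathcal{F}]=N_1[N_{j-1}[\mathcal{F}]]$, and for a single edge $o$, $N_j[o]=N_j[\{o\}]$. Subset-Test-$r$-Cover$(m-k)$: given a hypergraph $(V,\mathcal{E})$ with every edge of size at most $r$ and $\mathcal{E}$ a test cover, a subset $\mathcal{B}\subseteq\mathcal{E}$ of black edges required to be in the solution, and an integer $k$, decide whether there is a test cover $\mathcal{T}$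 with $\mathcal{B}\subseteq\mathcal{T}\subseteq\mathcal{E}$ and $|\mathcal{T}|\le|\mathcal{E}|-k$. Rule 1: if $x$ is a vertex of degree $1$ and $b\in\mathcal{B}$ with $b=\{x\}$, delete $b$ and $x$, keep $k$. Rule 2: given $b\in\mathcal{B}$, if another edge $e$ satisfies $b\subsetneq e$, replace $e$ by $e\setminus b$; if some $b'\in\mathcal{B}$ is such that $b$ cuts $b'$ and $b'$ cuts $b$, replace $b,b'$ by black edges $b\setminus b'$, $b'\setminus b$, $b\cap b'$; keep $k$. Coloring: each non-black edge $e$ with $\mathcal{E}\setminus\{e\}$ not a test cover is colored black (added to $\mathcal{B}$, with Rules 1 and 2 reapplied); a non-black edge $e$ with $\mathcal{E}\setminus\{e\}$ a test cover is colored orange if it contains a vertex of degree $1$, and green otherwise. -}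

module Defs where

open import Data.Nat using (ℕ; suc; _≤_; _*_; _+_; _∸_)
open import Data.Fin using (Fin; punchIn)
open import Data.Fin.Subset using (Subset; _∈_; _∉_; _⊆_; _⊂_; ∣_∣; _∩_; _─_; ⊤; ⁅_⁆; _-_; Nonempty)
open import Data.Vec using (tabulate; lookup)
open import Data.Product using (Σ; ∃; _×_; _,_)
open import Data.Sum using (_⊎_)
open import Relation.Binary.PropositionalEquality using (_≡_; _≢_)
open import Relation.Nullary using (¬_)

-- A hypergraph on vertex set Fin n with m edges, given as an indexed
-- family of edges (so repeated edges are allowed; edges are identified
-- by their index).
Hypergraph : ℕ → ℕ → Set
Hypergraph n m = Fin m → Subset n

module _ {n m : ℕ} where

  Separates : Subset n → Fin n → Fin n → Set
  Separates e x y = (x ∈ e × y ∉ e) ⊎ (x ∉ e × y ∈ e)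

  IsTestCover : Hypergraph n m → Subset m → Set
  IsTestCover E T = ∀ (x y : Fin n) → x ≢ y → ∃ λ i → i ∈ T × Separates (E i) x y

  degree : Hypergraph n m → Fin n → ℕ
  degree E x = ∣ tabulate (λ i → lookup (E i) x) ∣

  Cuts : Subset n → Subset n → Set
  Cuts e X = Nonempty (X ∩ e) × Nonempty (X ─ e)

  Rule1Applies : Hypergraph n m → Subset m → Set
  Rule1Applies E B = ∃ λ x → ∃ λ b → b ∈ B × degree E x ≡ 1 × E b ≡ ⁅ x ⁆

  Rule2Applies : Hypergraph n m → Subset m → Set
  Rule2Applies E B =
    (∃ λ b → ∃ λ e → b ∈ B × b ≢ e × E b ⊂ E e)
    ⊎ (∃ λ b → ∃ λ b' → b ∈ B × b' ∈ B × Cuts (E b) (E b') × Cuts (E b') (E b))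

  Redundant : Hypergraph n m → Fin m → Set
  Redundant E e = IsTestCover E (⊤ - e)

  -- the coloring has been carried out: every non-black edge is redundant
  Colored : Hypergraph n m → Subset m → Set
  Colored E B = ∀ e → e ∉ B → Redundant E e

  Orange : Hypergraph n m → Subset m → Fin m → Set
  Orange E B e = e ∉ B × Redundant E e × (∃ λ x → x ∈ E e × degree E x ≡ 1)

  Green : Hypergraph n m → Subset m → Fin m → Set
  Green E B e = e ∉ B × Redundant E e × (∀ x → x ∈ E e → degree E x ≢ 1)

  N1 : Hypergraph n m → (Fin m → Set) → (Fin m → Set)
  N1 E F e = F e ⊎ (∃ λ f → F f × Nonempty (E f ∩ E e))

  N2 : Hypergraph n m → Fin m → (Fin m → Set)
  N2 E o = N1 E (N1 E (λ e → e ≡ o))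

  IsInstance : ℕ → Hypergraph n m → Subset m → Set
  IsInstance r E B = (∀ i → ∣ E i ∣ ≤ r) × IsTestCover E ⊤

  -- yes-instance: a test cover T with B ⊆ T ⊆ E and |T| ≤ |E| - k
  -- (stated as |T| + k ≤ |E| to avoid truncated subtraction)
  YesInstance : Hypergraph n m → Subset m → ℕ → Set
  YesInstance E B k = ∃ λ T → B ⊆ T × IsTestCover E T × ∣ T ∣ + k ≤ m

deleteEdge : {n m : ℕ} → Hypergraph n (suc m) → Fin (suc m) → Hypergraph n m
deleteEdge E o i = E (punchIn o i)

deleteBlack : {m : ℕ} → Subset (suc m) → Fin (suc m) → Subset m
deleteBlack B o = tabulate (λ i → lookup B (punchIn o i))

-- Take an optimal solution T. If o ∈ T, let x be the degree-1 vertex of o. If some pair p ∈ o,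
-- q ∉ o is separated by o alone, then either p = x and q lies in no edge of T, or some edge
-- f ∈ T contains p and q and the redundancy of o yields an edge g ∉ T separating p and q;
-- g ∈ N₂[o] is not green, so it has a degree-1 vertex, which again lies in no edge of T.
-- A test cover leaves at most one vertex z uncovered, and every edge other than o through that
-- vertex separates the pair. So either T - o is already a test cover, or trading o for an edge
-- e separating x from z is; in both cases the solution avoids o and survives the deletion.
module Submission where

open import Defs
open import Data.Nat using (ℕ; suc; zero; _≤_; _<_; _*_; _∸_; _+_; z≤n; s≤s; s≤s⁻¹)
open import Data.Nat.Properties
  using (≤-refl; ≤-trans; <⇒≤; <-irrefl; +-suc; +-comm; +-identityʳ; +-monoˡ-≤; +-monoʳ-≤;
         n≤1+n; m≤n⇒m≤1+n; module ≤-Reasoning) renaming (_≟_ to _ℕ-≟_)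
open import Data.Bool using (Bool)
open import Data.Fin using (Fin; punchIn; punchOut; _≟_)
open import Data.Fin.Properties using (any?; all?; punchIn-punchOut)
open import Data.Fin.Subset
  using (Subset; _∈_; _∉_; _⊆_; ∣_∣; _∪_; _─_; ⊤; ⁅_⁆; _-_; inside; outside)
open import Data.Fin.Subset.Properties
  using (_∈?_; ∣p∣≤n; ∣p∣≤∣x∷p∣; ∣⁅x⁆∣≡1; x∈⁅x⁆; x∈⁅y⁆⇒x≡y; x∉⁅y⁆⇒x≢y; p⊆q⇒∣p∣≤∣q∣;
         x∈p∧x≢y⇒x∈p-y; x∈p⇒∣p-x∣<∣p∣; x∈p∩q⁺; x∈p∪q⁺; x∈p∪q⁻)
open import Data.Vec using ([]; _∷_; tabulate; lookup; insertAt; here; there)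
open import Data.Vec.Properties
  using (lookup∘tabulate; tabulate∘lookup; []=⇒lookup; lookup⇒[]=; insertAt-punchIn)
open import Data.Product using (∃; _×_; _,_)
open import Data.Sum using (inj₁; inj₂)
open import Relation.Binary.PropositionalEquality using (_≡_; _≢_; refl; sym; trans; cong; subst)
open import Relation.Nullary using (¬_; Dec; yes; no; contradiction)
open import Relation.Nullary.Decidable using (_×-dec_; _⊎-dec_; ¬?; _→-dec_)
open import Function.Base using (id)
open import Function.Bundles using (_⇔_; mk⇔)

∈-tabulate⁺ : ∀ {n} {f : Fin n → Bool} {i} → f i ≡ inside → i ∈ tabulate f
∈-tabulate⁺ {f = f} {i} fi = lookup⇒[]= i _ (trans (lookup∘tabulate f i) fi)

∈-tabulate⁻ : ∀ {n} {f : Fin n → Bool} {i} → i ∈ tabulate f → f i ≡ inside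
∈-tabulate⁻ {f = f} {i} i∈ = trans (sym (lookup∘tabulate f i)) ([]=⇒lookup i∈)

x∈p─q⇒x∉q : ∀ {n} {p q : Subset n} {x} → x ∈ p ─ q → x ∉ q
x∈p─q⇒x∉q {p = _ ∷ _} {outside ∷ _} here      ()
x∈p─q⇒x∉q {p = _ ∷ _} {_ ∷ _}       (there h) (there h′) = x∈p─q⇒x∉q h h′

x∈p-y⇒x≢y : ∀ {n} {p : Subset n} {x y} → x ∈ p - y → x ≢ y
x∈p-y⇒x≢y h = x∉⁅y⁆⇒x≢y (x∈p─q⇒x∉q h)

∣p∪q∣≤∣p∣+∣q∣ : ∀ {n} (p q : Subset n) → ∣ p ∪ q ∣ ≤ ∣ p ∣ + ∣ q ∣
∣p∪q∣≤∣p∣+∣q∣ []            []            = z≤n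
∣p∪q∣≤∣p∣+∣q∣ (outside ∷ p) (outside ∷ q) = ∣p∪q∣≤∣p∣+∣q∣ p q
∣p∪q∣≤∣p∣+∣q∣ (inside  ∷ p) (outside ∷ q) = s≤s (∣p∪q∣≤∣p∣+∣q∣ p q)
∣p∪q∣≤∣p∣+∣q∣ (outside ∷ p) (inside  ∷ q) =
  subst (suc ∣ p ∪ q ∣ ≤_) (sym (+-suc ∣ p ∣ ∣ q ∣)) (s≤s (∣p∪q∣≤∣p∣+∣q∣ p q))
∣p∪q∣≤∣p∣+∣q∣ (inside  ∷ p) (inside  ∷ q) =
  s≤s (≤-trans (∣p∪q∣≤∣p∣+∣q∣ p q) (+-monoʳ-≤ ∣ p ∣ (n≤1+n ∣ q ∣)))

∣p∣≡1⇒x∈p⇒y∈p⇒x≡y : ∀ {n} (p : Subset n) {x y} → ∣ p ∣ ≡ 1 → x ∈ p → y ∈ p → x ≡ y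
∣p∣≡1⇒x∈p⇒y∈p⇒x≡y p {x} {y} ∣p∣≡1 x∈p y∈p with x ≟ y
... | yes x≡y = x≡y
... | no  x≢y = contradiction 1<1 (<-irrefl refl)
  where
  open ≤-Reasoning
  ⁅x⁆⊆p-y : ⁅ x ⁆ ⊆ p - y
  ⁅x⁆⊆p-y h = subst (_∈ p - y) (sym (x∈⁅y⁆⇒x≡y x h)) (x∈p∧x≢y⇒x∈p-y x∈p x≢y)
  1<1 : 1 < 1
  1<1 = begin-strict
    1           ≡⟨ sym (∣⁅x⁆∣≡1 x) ⟩
    ∣ ⁅ x ⁆ ∣   ≤⟨ p⊆q⇒∣p∣≤∣q∣ ⁅x⁆⊆p-y ⟩
    ∣ p - y ∣   <⟨ x∈p⇒∣p-x∣<∣p∣ y∈p ⟩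
    ∣ p ∣       ≡⟨ ∣p∣≡1 ⟩
    1           ∎

m+o≤1+n⇒m+[o∸1]≤n : ∀ o {m n} → m ≤ n → m + o ≤ suc n → m + (o ∸ 1) ≤ n
m+o≤1+n⇒m+[o∸1]≤n zero    {m} {n} m≤n _  = subst (_≤ n) (sym (+-identityʳ m)) m≤n
m+o≤1+n⇒m+[o∸1]≤n (suc o) {m} {n} _   le = s≤s⁻¹ (subst (_≤ suc n) (+-suc m o) le)

m+[o∸1]≤n⇒m+o≤1+n : ∀ o {m n} → m ≤ suc n → m + (o ∸ 1) ≤ n → m + o ≤ suc n
m+[o∸1]≤n⇒m+o≤1+n zero    {m} {n} m≤1+n _  = subst (_≤ suc n) (sym (+-identityʳ m)) m≤1+n
m+[o∸1]≤n⇒m+o≤1+n (suc o) {m} {n} _     le = subst (_≤ suc n) (sym (+-suc m o)) (s≤s le)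

module _ {m : ℕ} where

  ∈-deleteBlack⁺ : ∀ {s : Subset (suc m)} {o i} → punchIn o i ∈ s → i ∈ deleteBlack s o
  ∈-deleteBlack⁺ h = ∈-tabulate⁺ ([]=⇒lookup h)

  ∈-deleteBlack⁻ : ∀ {s : Subset (suc m)} {o i} → i ∈ deleteBlack s o → punchIn o i ∈ s
  ∈-deleteBlack⁻ h = lookup⇒[]= _ _ (∈-tabulate⁻ h)

  ∈-insertAt⁺ : ∀ {s : Subset m} {o i} → i ∈ s → punchIn o i ∈ insertAt s o outside
  ∈-insertAt⁺ {s} {o} {i} h = lookup⇒[]= _ _ (trans (insertAt-punchIn s o outside i) ([]=⇒lookup h))

∣deleteBlack∣≤ : ∀ {m} (s : Subset (suc m)) o → ∣ deleteBlack s o ∣ ≤ ∣ s ∣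
∣deleteBlack∣≤ (b ∷ s) Fin.zero =
  subst (_≤ ∣ b ∷ s ∣) (cong ∣_∣ (sym (tabulate∘lookup s))) (∣p∣≤∣x∷p∣ b s)
∣deleteBlack∣≤ {suc m} (outside ∷ s) (Fin.suc o) = ∣deleteBlack∣≤ s o
∣deleteBlack∣≤ {suc m} (inside  ∷ s) (Fin.suc o) = s≤s (∣deleteBlack∣≤ s o)

∣insertAt-outside∣ : ∀ {m} (s : Subset m) o → ∣ insertAt s o outside ∣ ≡ ∣ s ∣
∣insertAt-outside∣ s             Fin.zero    = refl
∣insertAt-outside∣ (outside ∷ s) (Fin.suc o) = ∣insertAt-outside∣ s o
∣insertAt-outside∣ (inside  ∷ s) (Fin.suc o) = cong suc (∣insertAt-outside∣ s o)

module _ {n m : ℕ} (E : Hypergraph n m) where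

  SeparatedBy : Fin m → Fin n → Fin n → Set
  SeparatedBy j = Separates {m = m} (E j)

  separatedBy? : ∀ j x y → Dec (SeparatedBy j x y)
  separatedBy? j x y = ((x ∈? E j) ×-dec ¬? (y ∈? E j)) ⊎-dec (¬? (x ∈? E j) ×-dec (y ∈? E j))

  separatedBy-sym : ∀ {j x y} → SeparatedBy j x y → SeparatedBy j y x
  separatedBy-sym (inj₁ (x∈e , y∉e)) = inj₂ (y∉e , x∈e)
  separatedBy-sym (inj₂ (x∉e , y∈e)) = inj₁ (y∈e , x∉e)

  Unseparated : Subset m → Fin n → Fin n → Set
  Unseparated S x y = ∀ j → j ∈ S → ¬ SeparatedBy j x y

  Uncovered : Subset m → Fin n → Set
  Uncovered T z = ∀ i → i ∈ T → z ∉ E i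

  uncovered? : ∀ T z → Dec (Uncovered T z)
  uncovered? T z = all? (λ i → (i ∈? T) →-dec ¬? (z ∈? E i))

  uncovered-unique : ∀ {T z z′} → IsTestCover E T → Uncovered T z → Uncovered T z′ → z ≡ z′
  uncovered-unique {z = z} {z′} T-cover z-unc z′-unc with z ≟ z′
  ... | yes z≡z′ = z≡z′
  ... | no  z≢z′ with T-cover z z′ z≢z′
  ...   | j , j∈T , inj₁ (z∈j , _)  = contradiction z∈j (z-unc j j∈T)
  ...   | j , j∈T , inj₂ (_ , z′∈j) = contradiction z′∈j (z′-unc j j∈T)

  degree≡1⇒unique-edge : ∀ {y i j} → degree E y ≡ 1 → y ∈ E i → y ∈ E j → j ≡ i
  degree≡1⇒unique-edge {y} deg y∈i y∈j =
    ∣p∣≡1⇒x∈p⇒y∈p⇒x≡y (tabulate λ k → lookup (E k) y) deg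
      (∈-tabulate⁺ ([]=⇒lookup y∈j)) (∈-tabulate⁺ ([]=⇒lookup y∈i))

  test-cover-exchange : ∀ {T T* o} → IsTestCover E T → T - o ⊆ T* →
    (∀ {p q} → p ∈ E o → q ∉ E o → Unseparated (T - o) p q → ∃ λ j → j ∈ T* × SeparatedBy j p q) →
    IsTestCover E T*
  test-cover-exchange {T} {o = o} T-cover T-o⊆T* split p q p≢q with T-cover p q p≢q
  ... | j , j∈T , sep with j ≟ o
  ...   | no j≢o = j , T-o⊆T* (x∈p∧x≢y⇒x∈p-y j∈T j≢o) , sep
  ...   | yes refl with any? (λ i → (i ∈? T - o) ×-dec separatedBy? i p q)
  ...     | yes (i , i∈T-o , sep′) = i , T-o⊆T* i∈T-o , sep′
  ...     | no  none with sep
  ...       | inj₁ (p∈o , q∉o) = split p∈o q∉o λ i i∈ s → none (i , i∈ , s)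
  ...       | inj₂ (p∉o , q∈o) with split q∈o p∉o (λ i i∈ s → none (i , i∈ , separatedBy-sym s))
  ...         | i , i∈T* , s = i , i∈T* , separatedBy-sym s

module _ {n m : ℕ} (E : Hypergraph n (suc m)) (o : Fin (suc m)) where

  deleteEdge-testCover⁺ : ∀ {T} → o ∉ T → IsTestCover E T →
                          IsTestCover (deleteEdge E o) (deleteBlack T o)
  deleteEdge-testCover⁺ {T} o∉T T-cover p q p≢q with T-cover p q p≢q
  ... | j , j∈T , sep = punchOut o≢j , ∈-deleteBlack⁺ (subst (_∈ T) (sym j≡) j∈T) ,
                        subst (λ i → SeparatedBy E i p q) (sym j≡) sep
    where
    o≢j : o ≢ j
    o≢j refl = o∉T j∈T
    j≡ : punchIn o (punchOut o≢j) ≡ j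
    j≡ = punchIn-punchOut o≢j

  deleteEdge-testCover⁻ : ∀ {T} → IsTestCover (deleteEdge E o) T →
                          IsTestCover E (insertAt T o outside)
  deleteEdge-testCover⁻ T-cover p q p≢q with T-cover p q p≢q
  ... | i , i∈T , sep = punchIn o i , ∈-insertAt⁺ i∈T , sep

  -- The budget k ∸ 1 is truncated, so for k = 0 both instances ask for the same size bound.
  yesInstance-avoiding : ∀ {B T} k → B ⊆ T → o ∉ T → IsTestCover E T → ∣ T ∣ + k ≤ suc m →
    YesInstance (deleteEdge E o) (deleteBlack B o) (k ∸ 1)
  yesInstance-avoiding {T = T} k B⊆T o∉T T-cover size =
    deleteBlack T o ,
    (λ h → ∈-deleteBlack⁺ (B⊆T (∈-deleteBlack⁻ h))) ,
    deleteEdge-testCover⁺ o∉T T-cover ,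
    m+o≤1+n⇒m+[o∸1]≤n k (∣p∣≤n (deleteBlack T o))
      (≤-trans (+-monoˡ-≤ k (∣deleteBlack∣≤ T o)) size)

  yesInstance-deleteEdge : ∀ {B} k → o ∉ B →
    YesInstance (deleteEdge E o) (deleteBlack B o) (k ∸ 1) → YesInstance E B k
  yesInstance-deleteEdge {B} k o∉B (T , B⊆T , T-cover , size) =
    insertAt T o outside , B⊆ , deleteEdge-testCover⁻ T-cover ,
    subst (λ s → s + k ≤ suc m) (sym (∣insertAt-outside∣ T o))
      (m+[o∸1]≤n⇒m+o≤1+n k (m≤n⇒m≤1+n (∣p∣≤n T)) size)
    where
    B⊆ : B ⊆ insertAt T o outside
    B⊆ {b} b∈B = subst (_∈ insertAt T o outside) b≡
                   (∈-insertAt⁺ (B⊆T (∈-deleteBlack⁺ (subst (_∈ B) (sym b≡) b∈B))))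
      where
      o≢b : o ≢ b
      o≢b refl = o∉B b∈B
      b≡ : punchIn o (punchOut o≢b) ≡ b
      b≡ = punchIn-punchOut o≢b

module OrangeExchange {n m : ℕ} {E : Hypergraph n m} {B : Subset m} {o : Fin m}
  (colored : Colored E B) (no-green : ∀ e → N2 E o e → ¬ Green E B e)
  (o∉B : o ∉ B) (o-redundant : Redundant E o) {x : Fin n} (x∈o : x ∈ E o) (deg-x : degree E x ≡ 1)
  {T : Subset m} (B⊆T : B ⊆ T) (T-cover : IsTestCover E T) where

  only-o∋x : ∀ {i} → x ∈ E i → i ≡ o
  only-o∋x = degree≡1⇒unique-edge E deg-x x∈o

  separating-from-x⇒∈ : ∀ {e w} → e ≢ o → SeparatedBy E e x w → w ∈ E e
  separating-from-x⇒∈ e≢o (inj₁ (x∈e , _)) = contradiction (only-o∋x x∈e) e≢o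
  separating-from-x⇒∈ e≢o (inj₂ (_ , w∈e)) = w∈e

  non-black-near-o-has-degree-1-vertex : ∀ {g} → g ∉ B → N2 E o g →
                                         ∃ λ y → y ∈ E g × degree E y ≡ 1
  non-black-near-o-has-degree-1-vertex {g} g∉B g∈N₂
    with any? (λ y → (y ∈? E g) ×-dec (degree E y ℕ-≟ 1))
  ... | yes found = found
  ... | no  none  =
    contradiction (g∉B , colored g g∉B , λ y y∈g deg → none (y , y∈g , deg)) (no-green g g∈N₂)

  degree-1-vertex-uncovered : ∀ {y g} → degree E y ≡ 1 → y ∈ E g → g ∉ T → Uncovered E T y
  degree-1-vertex-uncovered deg y∈g g∉T i i∈T y∈i =
    g∉T (subst (_∈ T) (degree≡1⇒unique-edge E deg y∈g y∈i) i∈T)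

  Witness : Fin n → Fin n → Set
  Witness p q = ∃ λ z → Uncovered E T z × (∀ e → z ∈ E e → e ≢ o → SeparatedBy E e p q)

  separating-edge-outside⇒witness : ∀ {g p q} → g ∉ T → N2 E o g → SeparatedBy E g p q →
                                    Witness p q
  separating-edge-outside⇒witness {g} {p} {q} g∉T g∈N₂ sep
    with non-black-near-o-has-degree-1-vertex (λ g∈B → g∉T (B⊆T g∈B)) g∈N₂
  ... | y , y∈g , deg-y = y , degree-1-vertex-uncovered deg-y y∈g g∉T , λ e y∈e _ →
    subst (λ k → SeparatedBy E k p q) (sym (degree≡1⇒unique-edge E deg-y y∈g y∈e)) sep

  witness : ∀ {p q} → p ∈ E o → q ∉ E o → Unseparated E (T - o) p q → Witness p q
  witness {p} {q} p∈o q∉o unsep with p ≟ x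
  ... | yes refl = q , q-uncovered , λ e q∈e e≢o → inj₂ ((λ x∈e → e≢o (only-o∋x x∈e)) , q∈e)
    where
    q-uncovered : Uncovered E T q
    q-uncovered i i∈T q∈i with i ≟ o
    ... | yes refl = q∉o q∈i
    ... | no  i≢o  = unsep i (x∈p∧x≢y⇒x∈p-y i∈T i≢o) (inj₂ ((λ x∈i → i≢o (only-o∋x x∈i)) , q∈i))
  ... | no p≢x with T-cover p x p≢x
  ...   | _ , _ , inj₂ (p∉j , x∈j) =
    contradiction (subst (λ k → p ∈ E k) (sym (only-o∋x x∈j)) p∈o) p∉j
  ...   | f , f∈T , inj₁ (p∈f , x∉f) with q ∈? E f
  ...     | no  q∉f = contradiction (inj₁ (p∈f , q∉f)) (unsep f f∈T-o)
    where
    f∈T-o : f ∈ T - o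
    f∈T-o = x∈p∧x≢y⇒x∈p-y f∈T λ { refl → x∉f x∈o }
  ...     | yes q∈f with o-redundant p q (λ { refl → q∉o p∈o })
  ...       | g , g∈⊤-o , sep = separating-edge-outside⇒witness g∉T (separating⇒∈N₂ sep) sep
    where
    g∉T : g ∉ T
    g∉T g∈T = unsep g (x∈p∧x≢y⇒x∈p-y g∈T (x∈p-y⇒x≢y g∈⊤-o)) sep
    -- An edge separating p and q meets o at p, or meets f (which meets o at p) at q.
    separating⇒∈N₂ : ∀ {e} → SeparatedBy E e p q → N2 E o e
    separating⇒∈N₂ (inj₁ (p∈e , _)) = inj₁ (inj₂ (o , refl , p , x∈p∩q⁺ (p∈o , p∈e)))
    separating⇒∈N₂ (inj₂ (_ , q∈e)) =
      inj₂ (f , inj₂ (o , refl , p , x∈p∩q⁺ (p∈o , p∈f)) , q , x∈p∩q⁺ (q∈f , q∈e))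

  AvoidingSolution : Set
  AvoidingSolution = ∃ λ T* → B ⊆ T* × o ∉ T* × IsTestCover E T* × ∣ T* ∣ ≤ ∣ T ∣

  B⊆T-o : B ⊆ T - o
  B⊆T-o b∈B = x∈p∧x≢y⇒x∈p-y (B⊆T b∈B) λ { refl → o∉B b∈B }

  o∉T-o : o ∉ T - o
  o∉T-o o∈T-o = x∈p-y⇒x≢y o∈T-o refl

  drop-o : o ∈ T → (∀ z → ¬ Uncovered E T z) → AvoidingSolution
  drop-o o∈T none-uncovered =
    T - o , B⊆T-o , o∉T-o , test-cover-exchange E T-cover id split , <⇒≤ (x∈p⇒∣p-x∣<∣p∣ o∈T)
    where
    split : ∀ {p q} → p ∈ E o → q ∉ E o → Unseparated E (T - o) p q →
            ∃ λ j → j ∈ T - o × SeparatedBy E j p q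
    split p∈o q∉o unsep with witness p∈o q∉o unsep
    ... | z , z-uncovered , _ = contradiction z-uncovered (none-uncovered z)

  trade-o : ∀ {z} → o ∈ T → Uncovered E T z → AvoidingSolution
  trade-o {z} o∈T z-uncovered with o-redundant x z (λ { refl → z-uncovered o o∈T x∈o })
  ... | e , e∈⊤-o , x|z = T* , (λ b∈B → x∈p∪q⁺ (inj₁ (B⊆T-o b∈B))) , o∉T* ,
                          test-cover-exchange E T-cover (λ h → x∈p∪q⁺ (inj₁ h)) split , T*≤T
    where
    e≢o : e ≢ o
    e≢o = x∈p-y⇒x≢y e∈⊤-o
    z∈e : z ∈ E e
    z∈e = separating-from-x⇒∈ e≢o x|z
    T* : Subset m
    T* = (T - o) ∪ ⁅ e ⁆
    o∉T* : o ∉ T*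
    o∉T* o∈T* with x∈p∪q⁻ (T - o) ⁅ e ⁆ o∈T*
    ... | inj₁ o∈T-o = o∉T-o o∈T-o
    ... | inj₂ o∈⁅e⁆ = e≢o (sym (x∈⁅y⁆⇒x≡y e o∈⁅e⁆))
    T*≤T : ∣ T* ∣ ≤ ∣ T ∣
    T*≤T = begin
      ∣ T* ∣                ≤⟨ ∣p∪q∣≤∣p∣+∣q∣ (T - o) ⁅ e ⁆ ⟩
      ∣ T - o ∣ + ∣ ⁅ e ⁆ ∣  ≡⟨ cong (∣ T - o ∣ +_) (∣⁅x⁆∣≡1 e) ⟩
      ∣ T - o ∣ + 1         ≡⟨ +-comm ∣ T - o ∣ 1 ⟩
      suc ∣ T - o ∣         ≤⟨ x∈p⇒∣p-x∣<∣p∣ o∈T ⟩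
      ∣ T ∣                 ∎
      where open ≤-Reasoning
    -- Every witness is the unique uncovered vertex z, which e contains.
    split : ∀ {p q} → p ∈ E o → q ∉ E o → Unseparated E (T - o) p q →
            ∃ λ j → j ∈ T* × SeparatedBy E j p q
    split p∈o q∉o unsep with witness p∈o q∉o unsep
    ... | z′ , z′-uncovered , separates-via-z′ =
      e , x∈p∪q⁺ (inj₂ (x∈⁅x⁆ e)) ,
      separates-via-z′ e (subst (_∈ E e) (uncovered-unique E T-cover z-uncovered z′-uncovered) z∈e)
                       e≢o

  orange-avoidable : AvoidingSolution
  orange-avoidable with o ∈? T
  ... | no  o∉T = T , B⊆T , o∉T , T-cover , ≤-refl
  ... | yes o∈T with any? (uncovered? E T)
  ...   | yes (z , z-uncovered) = trade-o o∈T z-uncovered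
  ...   | no  none-uncovered    = drop-o o∈T λ z z-uncovered → none-uncovered (z , z-uncovered)

lemma14 : (r k n m : ℕ) (E : Hypergraph n (suc m)) (B : Subset (suc m)) (o : Fin (suc m)) →
    IsInstance r E B →
    ¬ Rule1Applies E B →
    ¬ Rule2Applies E B →
    (∀ x → degree E x ≤ k * (r * r)) →
    Colored E B →
    Orange E B o →
    (∀ e → N2 E o e → ¬ Green E B e) →
    YesInstance (deleteEdge E o) (deleteBlack B o) (k ∸ 1) ⇔ YesInstance E B k
lemma14 r k n m E B o _ _ _ _ colored (o∉B , o-redundant , x , x∈o , deg-x) no-green =
  mk⇔ (yesInstance-deleteEdge E o k o∉B) from
  where
  from : YesInstance E B k → YesInstance (deleteEdge E o) (deleteBlack B o) (k ∸ 1)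
  from (T , B⊆T , T-cover , size) with OrangeExchange.orange-avoidable
    colored no-green o∉B o-redundant x∈o deg-x B⊆T T-cover
  ... | T* , B⊆T* , o∉T* , T*-cover , T*≤T =
    yesInstance-avoiding E o k B⊆T* o∉T* T*-cover (≤-trans (+-monoˡ-≤ k T*≤T) size)
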